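{- Let $G=G_L\otimes G_R$ be a cograph (the join of cographs $G_L=(V_L,E_L)$ and $G_R=(V_R,E_R)$) with restricted vertex set $\mathcal{R}$, and let $\mathcal{R}_L=\mathcal{R}\cap V_L$, $\mathcal{R}_R=\mathcal{R}\cap V_R$. If $|\mathcal{R}_L|=|\mathcal{R}_R|$ and $|\mathcal{R}_L|>0$, then there exists a canonical matched-paired-dominating set $CMPD$ of $G$ w.r.t. $\mathcal{R}$ such that $V(CMPD)=\mathcal{R}$, $|CMPD|=|\mathcal{R}|/2$, and $CMPD$ contains no free-paired-edge.
   Context: All graphs are finite, simple and undirected. A cograph is a graph with no induced path on four vertices. The join $G_L\otimes G_R$ has vertex set $V_L\cup V_R$ ($V_L\cap V_R=\emptyset$) and edge set $E_L\cup E_R\cup\{uv: u\in V_L, v\in V_R\}$. For a graph $G=(V,E)$ without isolated vertices and $\mathcal{R}\subseteq V$: a set $S\subseteq V$ is a paired-dominating set if every vertex of $V-S$ has a neighbor in $S$ and $G[S]$ has a perfect matching. A set $MPD\subseteq E$ is a matched-paired-dominating set if it is a perfect matching of $G[S]$ for some paired-dominating set $S$; $V(MPD)$ is the set of vertices incident to edges of $MPD$. The matched number of $MPD$ is $|V(MPD)\cap\mathcal{R}|$; a maximum matched-paired-dominating set maximizes it. A free-paired-edge is an edge of $MPD$ with no endpoint in $\mathcal{R}$. A canonical matched-paired-dominating set w.r.t. $\mathcal{R}$ is a maximum one with the least number of free-paired-edges among all maximum ones. -}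

module Defs where

open import Data.Nat using (ℕ; zero; suc; _+_; _≤_)
open import Data.Bool using (Bool; true; false; not; _∧_; if_then_else_)
open import Data.Fin using (Fin; splitAt; _↑ˡ_; _↑ʳ_)
open import Data.Fin.Subset using (Subset)
open import Data.Vec using (lookup; tabulate)
open import Data.List using (List; []; _∷_; _++_; length)
open import Data.List.Relation.Unary.All using (All)
open import Data.List.Relation.Unary.Unique.Propositional using (Unique)
open import Data.List.Membership.Propositional renaming (_∈_ to _∈ₗ_; _∉_ to _∉ₗ_)
open import Data.Product using (_×_; _,_; proj₁; proj₂; ∃-syntax)
open import Data.Sum using (_⊎_; inj₁; inj₂)
open import Relation.Binary.PropositionalEquality using (_≡_; refl)

record Graph (n : ℕ) : Set where
  field
    adj    : Fin n → Fin n → Bool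
    sym    : ∀ u v → adj u v ≡ adj v u
    irrefl : ∀ v → adj v v ≡ false
open Graph public

InducedP4 : ∀ {n} → Graph n → Fin n → Fin n → Fin n → Fin n → Set
InducedP4 G a b c d =
  adj G a b ≡ true × adj G b c ≡ true × adj G c d ≡ true ×
  adj G a c ≡ false × adj G b d ≡ false × adj G a d ≡ false

IsCograph : ∀ {n} → Graph n → Set
IsCograph {n} G = ∀ (a b c d : Fin n) → InducedP4 G a b c d → Data.Empty.⊥
  where import Data.Empty

-- Join G_L ⊗ G_R on Fin (a + b): the first a vertices are V_L (i ↑ˡ b),
-- the last b vertices are V_R (a ↑ʳ j).
joinAdj : ∀ {a b} → Graph a → Graph b → Fin (a + b) → Fin (a + b) → Bool
joinAdj {a} GL GR x y with splitAt a x | splitAt a y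
... | inj₁ i | inj₁ j = adj GL i j
... | inj₂ i | inj₂ j = adj GR i j
... | inj₁ _ | inj₂ _ = true
... | inj₂ _ | inj₁ _ = true

joinSym : ∀ {a b} (GL : Graph a) (GR : Graph b) u v → joinAdj GL GR u v ≡ joinAdj GL GR v u
joinSym {a} GL GR x y with splitAt a x | splitAt a y
... | inj₁ i | inj₁ j = sym GL i j
... | inj₂ i | inj₂ j = sym GR i j
... | inj₁ _ | inj₂ _ = refl
... | inj₂ _ | inj₁ _ = refl

joinIrrefl : ∀ {a b} (GL : Graph a) (GR : Graph b) v → joinAdj GL GR v v ≡ false
joinIrrefl {a} GL GR x with splitAt a x
... | inj₁ i = irrefl GL i
... | inj₂ i = irrefl GR i

_⊗_ : ∀ {a b} → Graph a → Graph b → Graph (a + b)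
GL ⊗ GR = record { adj = joinAdj GL GR ; sym = joinSym GL GR ; irrefl = joinIrrefl GL GR }

leftPart : ∀ {a b} → Subset (a + b) → Subset a
leftPart {a} {b} R = tabulate (λ i → lookup R (i ↑ˡ b))

rightPart : ∀ {a b} → Subset (a + b) → Subset b
rightPart {a} {b} R = tabulate (λ j → lookup R (a ↑ʳ j))

endpoints : ∀ {n} → List (Fin n × Fin n) → List (Fin n)
endpoints []             = []
endpoints ((u , v) ∷ es) = u ∷ v ∷ endpoints es

-- A matched-paired-dominating set: a list of edges of G that is a matching
-- (all endpoints pairwise distinct, so it is a perfect matching of G[V(M)])
-- and whose vertex set S = V(M) dominates G.
record IsMPD {n} (G : Graph n) (M : List (Fin n × Fin n)) : Set where
  field
    edges      : All (λ e → adj G (proj₁ e) (proj₂ e) ≡ true) M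
    matching   : Unique (endpoints M)
    dominating : ∀ v → v ∉ₗ endpoints M → ∃[ u ] (u ∈ₗ endpoints M × adj G v u ≡ true)

countIn : ∀ {n} → Subset n → List (Fin n) → ℕ
countIn R []       = 0
countIn R (v ∷ vs) = if lookup R v then suc (countIn R vs) else countIn R vs

matchedNumber : ∀ {n} → Subset n → List (Fin n × Fin n) → ℕ
matchedNumber R M = countIn R (endpoints M)

freeEdges : ∀ {n} → Subset n → List (Fin n × Fin n) → ℕ
freeEdges R []             = 0
freeEdges R ((u , v) ∷ es) =
  if not (lookup R u) ∧ not (lookup R v) then suc (freeEdges R es) else freeEdges R es

IsMaximumMPD : ∀ {n} → Graph n → Subset n → List (Fin n × Fin n) → Set
IsMaximumMPD G R M =
  IsMPD G M × (∀ M' → IsMPD G M' → matchedNumber R M' ≤ matchedNumber R M)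

IsCanonicalMPD : ∀ {n} → Graph n → Subset n → List (Fin n × Fin n) → Set
IsCanonicalMPD G R M =
  IsMaximumMPD G R M × (∀ M' → IsMaximumMPD G R M' → freeEdges R M ≤ freeEdges R M')

-- Pair the elements of R ∩ V_L with those of R ∩ V_R in any order.  Every
-- left–right pair is an edge of the join, the two heads of the matching
-- dominate the opposite sides, and V(M) = R.  A matching saturating exactly R
-- attains the largest conceivable matched number |R| and has no free edge, so
-- it is canonical.
module Submission where

open import Defs hiding (sym)
open import Data.Nat using (ℕ; _+_; _/_; _<_)
open import Data.Fin using (Fin)
open import Data.Fin.Subset using (Subset; _∈_; ∣_∣)
open import Data.List using (List; length)
open import Data.List.Membership.Propositional renaming (_∈_ to _∈ₗ_)
open import Data.Product using (Σ-syntax; _×_)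
open import Relation.Binary.PropositionalEquality using (_≡_)

open import Data.Nat using (suc; _≤_; _*_; z≤n; s≤s)
import Data.Nat.Properties as ℕ
open import Data.Nat.Properties using (m≤n⇒m≤1+n; module ≤-Reasoning)
open import Data.Nat.DivMod using (m*n/n≡m)
open import Data.Bool using (true; false)
open import Data.Fin using (zero; suc; splitAt; _↑ˡ_; _↑ʳ_)
open import Data.Fin.Properties
  using (suc-injective; splitAt-↑ˡ; splitAt-↑ʳ; splitAt⁻¹-↑ˡ; splitAt⁻¹-↑ʳ; ↑ˡ-injective; ↑ʳ-injective)
open import Data.Fin.Subset using (inside; outside; _-_)
open import Data.Fin.Subset.Properties using (x∈p∧x≢y⇒x∈p-y; x∈p⇒∣p-x∣<∣p∣)
open import Data.Vec using ([]; _∷_; lookup; tabulate; here; there)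
open import Data.Vec.Properties using (lookup∘tabulate; tabulate∘lookup; []=⇒lookup; lookup⇒[]=)
open import Data.List using ([]; _∷_; _++_; map; zipWith)
open import Data.List.Properties using (length-map; length-++)
open import Data.List.Relation.Unary.All as All using (All; []; _∷_)
open import Data.List.Relation.Unary.Any using (here; there)
open import Data.List.Relation.Unary.Unique.Propositional using (Unique; []; _∷_)
import Data.List.Relation.Unary.Unique.Propositional.Properties as Unique
open import Data.List.Membership.Propositional.Properties using (∈-map⁺; ∈-map⁻; ∈-++⁺ˡ; ∈-++⁺ʳ; ∈-++⁻)
open import Data.List.Relation.Binary.Permutation.Propositional using (_↭_; ↭-refl; ↭-sym; ↭-trans; ↭-prep; ↭⇒↭ₛ′)
open import Data.List.Relation.Binary.Permutation.Propositional.Properties using (shift; ∈-resp-↭; ↭-length)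
import Data.List.Relation.Binary.Permutation.Setoid.Properties as SetoidPermutation
open import Data.Product using (_,_; proj₁; proj₂; ∃-syntax)
open import Data.Empty using (⊥)
open import Data.Sum using (inj₁; inj₂)
open import Function using (_∘_)
open import Relation.Nullary using (contradiction)
open import Relation.Binary.PropositionalEquality
  using (refl; sym; trans; cong; cong₂; subst; _≢_; ≢-sym; module ≡-Reasoning)
open import Relation.Binary.PropositionalEquality.Properties using (setoid; isEquivalence)

private
  variable
    n a b : ℕ

Unique-resp-↭ : {A : Set} {xs ys : List A} → xs ↭ ys → Unique xs → Unique ys
Unique-resp-↭ {A} p = SetoidPermutation.Unique-resp-↭ (setoid A) (↭⇒↭ₛ′ isEquivalence p)

∈⇒lookup : {p : Subset n} {x : Fin n} → x ∈ p → lookup p x ≡ true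
∈⇒lookup = []=⇒lookup

lookup⇒∈ : {p : Subset n} {x : Fin n} → lookup p x ≡ true → x ∈ p
lookup⇒∈ {p = p} {x} = lookup⇒[]= x p

elements : Subset n → List (Fin n)
elements []            = []
elements (inside ∷ p)  = zero ∷ map suc (elements p)
elements (outside ∷ p) = map suc (elements p)

length-elements : (p : Subset n) → length (elements p) ≡ ∣ p ∣
length-elements []            = refl
length-elements (inside ∷ p)  = cong suc (trans (length-map suc (elements p)) (length-elements p))
length-elements (outside ∷ p) = trans (length-map suc (elements p)) (length-elements p)

∈-elements⁺ : {p : Subset n} {x : Fin n} → x ∈ p → x ∈ₗ elements p
∈-elements⁺ here                          = here refl
∈-elements⁺ {p = inside ∷ p}  (there x∈p) = there (∈-map⁺ suc (∈-elements⁺ x∈p))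
∈-elements⁺ {p = outside ∷ p} (there x∈p) = ∈-map⁺ suc (∈-elements⁺ x∈p)

∈-elements⁻ : (p : Subset n) {x : Fin n} → x ∈ₗ elements p → x ∈ p
∈-elements⁻ (inside ∷ p) (here refl) = here
∈-elements⁻ (inside ∷ p) (there x∈) with ∈-map⁻ suc x∈
... | _ , y∈ , refl = there (∈-elements⁻ p y∈)
∈-elements⁻ (outside ∷ p) x∈ with ∈-map⁻ suc x∈
... | _ , y∈ , refl = there (∈-elements⁻ p y∈)

zero≢map-suc : (xs : List (Fin n)) → All (zero ≢_) (map suc xs)
zero≢map-suc []       = []
zero≢map-suc (_ ∷ xs) = (λ ()) ∷ zero≢map-suc xs

elements-unique : (p : Subset n) → Unique (elements p)
elements-unique []            = []
elements-unique (inside ∷ p)  =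
  zero≢map-suc (elements p) ∷ Unique.map⁺ suc-injective (elements-unique p)
elements-unique (outside ∷ p) = Unique.map⁺ suc-injective (elements-unique p)

countIn-mono : {p q : Subset n} (xs : List (Fin n)) →
               (∀ {x} → x ∈ₗ xs → x ∈ p → x ∈ q) → countIn p xs ≤ countIn q xs
countIn-mono [] _ = z≤n
countIn-mono {p = p} {q} (x ∷ xs) p⊆q with lookup p x in px | lookup q x in qx
... | true  | true  = s≤s (countIn-mono xs (p⊆q ∘ there))
... | true  | false = contradiction (trans (sym (∈⇒lookup (p⊆q (here refl) (lookup⇒∈ px)))) qx) λ ()
... | false | true  = m≤n⇒m≤1+n (countIn-mono xs (p⊆q ∘ there))
... | false | false = countIn-mono xs (p⊆q ∘ there)

-- Removing the counted head x from p keeps the count of the tail, since x ∉ xs.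
countIn≤∣p∣ : (p : Subset n) {xs : List (Fin n)} → Unique xs → countIn p xs ≤ ∣ p ∣
countIn≤∣p∣ p {[]}     []             = z≤n
countIn≤∣p∣ p {x ∷ xs} (x∉xs ∷ xs!) with lookup p x in px
... | false = countIn≤∣p∣ p xs!
... | true  = begin-strict
  countIn p xs       ≤⟨ countIn-mono xs (λ y∈xs y∈p → x∈p∧x≢y⇒x∈p-y y∈p (≢-sym (All.lookup x∉xs y∈xs))) ⟩
  countIn (p - x) xs ≤⟨ countIn≤∣p∣ (p - x) xs! ⟩
  ∣ p - x ∣          <⟨ x∈p⇒∣p-x∣<∣p∣ {p = p} (lookup⇒∈ px) ⟩
  ∣ p ∣              ∎
  where open ≤-Reasoning

countIn-⊆ : {p : Subset n} (xs : List (Fin n)) → (∀ {x} → x ∈ₗ xs → x ∈ p) → countIn p xs ≡ length xs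
countIn-⊆ []       _  = refl
countIn-⊆ (x ∷ xs) ⊆p rewrite ∈⇒lookup (⊆p (here refl)) = cong suc (countIn-⊆ xs (⊆p ∘ there))

length-endpoints : (M : List (Fin n × Fin n)) → length (endpoints M) ≡ length M * 2
length-endpoints []      = refl
length-endpoints (_ ∷ M) = cong (λ m → suc (suc m)) (length-endpoints M)

freeEdges-⊆ : {R : Subset n} (M : List (Fin n × Fin n)) →
              (∀ {v} → v ∈ₗ endpoints M → v ∈ R) → freeEdges R M ≡ 0
freeEdges-⊆ []            _  = refl
freeEdges-⊆ ((u , v) ∷ M) ⊆R rewrite ∈⇒lookup (⊆R (here refl)) = freeEdges-⊆ M (λ v∈ → ⊆R (there (there v∈)))

-- No matching can have more than |R| matched vertices, and V(M) ⊆ R rules out free edges.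
saturating-isCanonicalMPD : {G : Graph n} {R : Subset n} {M : List (Fin n × Fin n)} →
  IsMPD G M → (∀ {v} → v ∈ₗ endpoints M → v ∈ R) → length (endpoints M) ≡ ∣ R ∣ →
  IsCanonicalMPD G R M
saturating-isCanonicalMPD {R = R} {M} mpd ⊆R |V|≡|R| = (mpd , maximum) , leastFree
  where
  maximum : ∀ M' → IsMPD _ M' → matchedNumber R M' ≤ matchedNumber R M
  maximum M' mpd' = begin
    matchedNumber R M'    ≤⟨ countIn≤∣p∣ R (IsMPD.matching mpd') ⟩
    ∣ R ∣                 ≡⟨ sym |V|≡|R| ⟩
    length (endpoints M)  ≡⟨ sym (countIn-⊆ (endpoints M) ⊆R) ⟩
    matchedNumber R M     ∎
    where open ≤-Reasoning

  leastFree : ∀ M' → IsMaximumMPD _ R M' → freeEdges R M ≤ freeEdges R M'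
  leastFree _ _ rewrite freeEdges-⊆ M ⊆R = z≤n

data Side (a b : ℕ) : Fin (a + b) → Set where
  left  : (i : Fin a) → Side a b (i ↑ˡ b)
  right : (j : Fin b) → Side a b (a ↑ʳ j)

side : (v : Fin (a + b)) → Side a b v
side {a} v with splitAt a v in eq
... | inj₁ i rewrite sym (splitAt⁻¹-↑ˡ eq) = left i
... | inj₂ j rewrite sym (splitAt⁻¹-↑ʳ eq) = right j

↑ˡ≢↑ʳ : (i : Fin a) (j : Fin b) → i ↑ˡ b ≢ a ↑ʳ j
↑ˡ≢↑ʳ {a} {b} i j eq with trans (sym (splitAt-↑ˡ a i b)) (trans (cong (splitAt a) eq) (splitAt-↑ʳ a b j))
... | ()

module _ (GL : Graph a) (GR : Graph b) where

  ⊗-adj-↑ˡ-↑ʳ : (i : Fin a) (j : Fin b) → adj (GL ⊗ GR) (i ↑ˡ b) (a ↑ʳ j) ≡ true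
  ⊗-adj-↑ˡ-↑ʳ i j rewrite splitAt-↑ˡ a i b | splitAt-↑ʳ a b j = refl

  ⊗-adj-↑ʳ-↑ˡ : (j : Fin b) (i : Fin a) → adj (GL ⊗ GR) (a ↑ʳ j) (i ↑ˡ b) ≡ true
  ⊗-adj-↑ʳ-↑ˡ j i rewrite splitAt-↑ˡ a i b | splitAt-↑ʳ a b j = refl

module _ (R : Subset (a + b)) where

  ∈-leftPart⁺ : {i : Fin a} → i ↑ˡ b ∈ R → i ∈ leftPart {a} {b} R
  ∈-leftPart⁺ {i} i∈ = lookup⇒∈ (trans (lookup∘tabulate _ i) (∈⇒lookup i∈))

  ∈-leftPart⁻ : {i : Fin a} → i ∈ leftPart {a} {b} R → i ↑ˡ b ∈ R
  ∈-leftPart⁻ {i} i∈ = lookup⇒∈ (trans (sym (lookup∘tabulate _ i)) (∈⇒lookup i∈))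

  ∈-rightPart⁺ : {j : Fin b} → a ↑ʳ j ∈ R → j ∈ rightPart {a} {b} R
  ∈-rightPart⁺ {j} j∈ = lookup⇒∈ (trans (lookup∘tabulate _ j) (∈⇒lookup j∈))

  ∈-rightPart⁻ : {j : Fin b} → j ∈ rightPart {a} {b} R → a ↑ʳ j ∈ R
  ∈-rightPart⁻ {j} j∈ = lookup⇒∈ (trans (sym (lookup∘tabulate _ j)) (∈⇒lookup j∈))

∣p∣≡∣leftPart∣+∣rightPart∣ : (p : Subset (a + b)) → ∣ p ∣ ≡ ∣ leftPart {a} {b} p ∣ + ∣ rightPart {a} {b} p ∣
∣p∣≡∣leftPart∣+∣rightPart∣ {0}     p             = cong ∣_∣ (sym (tabulate∘lookup p))
∣p∣≡∣leftPart∣+∣rightPart∣ {suc a} (inside ∷ p)  = cong suc (∣p∣≡∣leftPart∣+∣rightPart∣ {a} p)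
∣p∣≡∣leftPart∣+∣rightPart∣ {suc a} (outside ∷ p) = ∣p∣≡∣leftPart∣+∣rightPart∣ {a} p

crossPairs : List (Fin a) → List (Fin b) → List (Fin (a + b) × Fin (a + b))
crossPairs {a} {b} = zipWith (λ i j → i ↑ˡ b , a ↑ʳ j)

sides : List (Fin a) → List (Fin b) → List (Fin (a + b))
sides {a} {b} Ls Rs = map (_↑ˡ b) Ls ++ map (a ↑ʳ_) Rs

length-sides : (Ls : List (Fin a)) (Rs : List (Fin b)) → length (sides Ls Rs) ≡ length Ls + length Rs
length-sides {a} {b} Ls Rs = begin
  length (map (_↑ˡ b) Ls ++ map (a ↑ʳ_) Rs)         ≡⟨ length-++ (map (_↑ˡ b) Ls) ⟩
  length (map (_↑ˡ b) Ls) + length (map (a ↑ʳ_) Rs) ≡⟨ cong₂ _+_ (length-map _ Ls) (length-map _ Rs) ⟩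
  length Ls + length Rs                             ∎
  where open ≡-Reasoning

sides-unique : {Ls : List (Fin a)} {Rs : List (Fin b)} → Unique Ls → Unique Rs → Unique (sides Ls Rs)
sides-unique {a} {b} Ls! Rs! =
  Unique.++⁺ (Unique.map⁺ (↑ˡ-injective b _ _) Ls!) (Unique.map⁺ (↑ʳ-injective a _ _) Rs!) disjoint
  where
  disjoint : ∀ {v Ls Rs} → v ∈ₗ map (_↑ˡ b) Ls × v ∈ₗ map (a ↑ʳ_) Rs → ⊥
  disjoint (v∈ˡ , v∈ʳ) with ∈-map⁻ _ v∈ˡ | ∈-map⁻ _ v∈ʳ
  ... | i , _ , refl | j , _ , eq = ↑ˡ≢↑ʳ i j eq

endpoints-crossPairs : (Ls : List (Fin a)) (Rs : List (Fin b)) → length Ls ≡ length Rs →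
                       endpoints (crossPairs Ls Rs) ↭ sides Ls Rs
endpoints-crossPairs []       []       _  = ↭-refl
endpoints-crossPairs {a} {b} (i ∷ Ls) (j ∷ Rs) eq =
  ↭-prep (i ↑ˡ b) (↭-trans (↭-prep (a ↑ʳ j) (endpoints-crossPairs Ls Rs (ℕ.suc-injective eq)))
                           (↭-sym (shift (a ↑ʳ j) (map (_↑ˡ b) Ls) (map (a ↑ʳ_) Rs))))

module _ (GL : Graph a) (GR : Graph b) where

  crossPairs-edges : (Ls : List (Fin a)) (Rs : List (Fin b)) →
                     All (λ e → adj (GL ⊗ GR) (proj₁ e) (proj₂ e) ≡ true) (crossPairs Ls Rs)
  crossPairs-edges []       _        = []
  crossPairs-edges (_ ∷ _)  []       = []
  crossPairs-edges (i ∷ Ls) (j ∷ Rs) = ⊗-adj-↑ˡ-↑ʳ GL GR i j ∷ crossPairs-edges Ls Rs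

  -- The first pair alone dominates: its left vertex sees all of V_R, its right vertex all of V_L.
  crossPairs-dominating : (Ls : List (Fin a)) (Rs : List (Fin b)) → 0 < length Ls → 0 < length Rs →
    ∀ v → ∃[ u ] (u ∈ₗ endpoints (crossPairs Ls Rs) × adj (GL ⊗ GR) v u ≡ true)
  crossPairs-dominating (i ∷ _) (j ∷ _) _ _ v with side {a} {b} v
  ... | left i′  = a ↑ʳ j , there (here refl) , ⊗-adj-↑ˡ-↑ʳ GL GR i′ j
  ... | right j′ = i ↑ˡ b , here refl , ⊗-adj-↑ʳ-↑ˡ GL GR j′ i

  crossPairs-isMPD : {Ls : List (Fin a)} {Rs : List (Fin b)} → Unique Ls → Unique Rs →
                     length Ls ≡ length Rs → 0 < length Ls → IsMPD (GL ⊗ GR) (crossPairs Ls Rs)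
  crossPairs-isMPD {Ls} {Rs} Ls! Rs! |Ls|≡|Rs| 0<|Ls| = record
    { edges      = crossPairs-edges Ls Rs
    ; matching   = Unique-resp-↭ (↭-sym (endpoints-crossPairs Ls Rs |Ls|≡|Rs|)) (sides-unique Ls! Rs!)
    ; dominating = λ v _ → crossPairs-dominating Ls Rs 0<|Ls| (subst (0 <_) |Ls|≡|Rs| 0<|Ls|) v
    }

module _ (R : Subset (a + b)) where

  elementsBySide : List (Fin (a + b))
  elementsBySide = sides (elements (leftPart {a} {b} R)) (elements (rightPart {a} {b} R))

  ∈-elementsBySide⁺ : {v : Fin (a + b)} → v ∈ R → v ∈ₗ elementsBySide
  ∈-elementsBySide⁺ {v} v∈R with side {a} {b} v
  ... | left i  = ∈-++⁺ˡ (∈-map⁺ _ (∈-elements⁺ (∈-leftPart⁺ R v∈R)))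
  ... | right j = ∈-++⁺ʳ (map (_↑ˡ b) (elements (leftPart {a} {b} R))) (∈-map⁺ _ (∈-elements⁺ (∈-rightPart⁺ R v∈R)))

  ∈-elementsBySide⁻ : {v : Fin (a + b)} → v ∈ₗ elementsBySide → v ∈ R
  ∈-elementsBySide⁻ v∈ with ∈-++⁻ (map (_↑ˡ b) (elements (leftPart {a} {b} R))) v∈
  ... | inj₁ v∈ˡ with ∈-map⁻ _ v∈ˡ
  ...   | _ , i∈ , refl = ∈-leftPart⁻ R (∈-elements⁻ _ i∈)
  ∈-elementsBySide⁻ v∈ | inj₂ v∈ʳ with ∈-map⁻ _ v∈ʳ
  ...   | _ , j∈ , refl = ∈-rightPart⁻ R (∈-elements⁻ _ j∈)

  length-elementsBySide : length elementsBySide ≡ ∣ R ∣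
  length-elementsBySide = begin
    length elementsBySide   ≡⟨ length-sides Ls Rs ⟩
    length Ls + length Rs   ≡⟨ cong₂ _+_ (length-elements Rˡ) (length-elements Rʳ) ⟩
    ∣ Rˡ ∣ + ∣ Rʳ ∣         ≡⟨ sym (∣p∣≡∣leftPart∣+∣rightPart∣ {a} {b} R) ⟩
    ∣ R ∣                   ∎
    where
    open ≡-Reasoning
    Rˡ = leftPart {a} {b} R
    Rʳ = rightPart {a} {b} R
    Ls = elements Rˡ
    Rs = elements Rʳ

lemma5 : ∀ {a b} (GL : Graph a) (GR : Graph b) (R : Subset (a + b)) →
         IsCograph GL → IsCograph GR →
         ∣ leftPart {a} {b} R ∣ ≡ ∣ rightPart {a} {b} R ∣ → 0 < ∣ leftPart {a} {b} R ∣ →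
         Σ[ M ∈ List (Fin (a + b) × Fin (a + b)) ]
           ( IsCanonicalMPD (GL ⊗ GR) R M
           × (∀ v → (v ∈ R → v ∈ₗ endpoints M) × (v ∈ₗ endpoints M → v ∈ R))
           × length M ≡ ∣ R ∣ / 2
           × freeEdges R M ≡ 0 )
lemma5 {a} {b} GL GR R _ _ |Rˡ|≡|Rʳ| 0<|Rˡ| =
  M , saturating-isCanonicalMPD mpd V⊆R |V|≡|R| , (λ _ → V⊇R , V⊆R) , |M|≡|R|/2 , freeEdges-⊆ M V⊆R
  where
  Rˡ = leftPart {a} {b} R
  Rʳ = rightPart {a} {b} R
  Ls = elements Rˡ
  Rs = elements Rʳ
  M  = crossPairs Ls Rs

  |Ls|≡|Rs| : length Ls ≡ length Rs
  |Ls|≡|Rs| = trans (length-elements Rˡ) (trans |Rˡ|≡|Rʳ| (sym (length-elements Rʳ)))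

  V↭ : endpoints M ↭ elementsBySide {a} {b} R
  V↭ = endpoints-crossPairs Ls Rs |Ls|≡|Rs|

  mpd : IsMPD (GL ⊗ GR) M
  mpd = crossPairs-isMPD GL GR (elements-unique Rˡ) (elements-unique Rʳ) |Ls|≡|Rs|
                         (subst (0 <_) (sym (length-elements Rˡ)) 0<|Rˡ|)

  V⊆R : ∀ {v} → v ∈ₗ endpoints M → v ∈ R
  V⊆R = ∈-elementsBySide⁻ {a} {b} R ∘ ∈-resp-↭ V↭

  V⊇R : ∀ {v} → v ∈ R → v ∈ₗ endpoints M
  V⊇R = ∈-resp-↭ (↭-sym V↭) ∘ ∈-elementsBySide⁺ {a} {b} R

  |V|≡|R| : length (endpoints M) ≡ ∣ R ∣
  |V|≡|R| = trans (↭-length V↭) (length-elementsBySide {a} {b} R)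

  |M|≡|R|/2 : length M ≡ ∣ R ∣ / 2
  |M|≡|R|/2 = trans (sym (m*n/n≡m (length M) 2)) (cong (_/ 2) (trans (sym (length-endpoints M)) |V|≡|R|))
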